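{- Let $T\in\binom{[n]}{k}$ with $1\notin T$ (so that $M=\langle T\rangle$ is a coloopless shifted matroid of rank $k$). If $T$ has exactly three blocks and the second gap of $T$ has size one, then $M$ is threshold.
   Context: For $T\in\binom{[n]}{k}$, $\langle T\rangle$ is the matroid on $[n]$ whose bases are the $k$-subsets $\{s_1<\dots<s_k\}$ with $s_i\le t_i$ for all $i$, where $T=\{t_1<\dots<t_k\}$. Blocks: $T$, written as an increasing word, decomposes uniquely as a concatenation of inclusion-maximal runs of consecutive integers, its blocks. The $j$-th gap of $T$ is the $j$-th block of $[n]\setminus T$; since $1\notin T$, the first gap precedes the first block and the second gap lies between the first and second blocks. A rank $k$ matroid on $E$ is threshold if there is $w:E\to\mathbb{R}$ such that a $k$-subset $B$ is a basis iff $\sum_{b\in B}w(b)>0$. -}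

module Defs where

open import Data.Nat using (ℕ; zero; suc; _≤_; _<_; _≡ᵇ_)
open import Data.Nat.Properties using (_≟_)
open import Data.Bool using (if_then_else_)
open import Data.List using (List; []; _∷_; [_]; length; map; filter; upTo; sum)
open import Data.List.Relation.Unary.All using (All)
open import Data.List.Relation.Binary.Pointwise using (Pointwise)
open import Data.List.Relation.Unary.Linked using (Linked)
open import Data.List.Membership.DecPropositional _≟_ using (_∈_; _∉_; _∈?_)
open import Relation.Nullary using (¬?)
open import Relation.Binary.PropositionalEquality using (_≡_)
open import Data.Product using (_×_; ∃)
open import Data.Maybe using (Maybe; just; nothing)
open import Function.Bundles using (_⇔_)
open import Data.Rational using (ℚ; 0ℚ) renaming (_+_ to _+ℚ_; _<_ to _<ℚ_)

[_]ₙ : ℕ → List ℕ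
[ n ]ₙ = map suc (upTo n)

IsKSubset : ℕ → ℕ → List ℕ → Set
IsKSubset n k S = Linked _<_ S × All (λ s → 1 ≤ s × s ≤ n) S × length S ≡ k

IsBasisOfShifted : ℕ → ℕ → List ℕ → List ℕ → Set
IsBasisOfShifted n k T S = IsKSubset n k S × Pointwise _≤_ S T

-- Decomposition of an increasing word into inclusion-maximal runs of
-- consecutive integers.
private
  consRun : ℕ → List (List ℕ) → List (List ℕ)
  consRun x [] = [ x ] ∷ []
  consRun x ([] ∷ rs) = [ x ] ∷ [] ∷ rs
  consRun x ((y ∷ ys) ∷ rs) =
    if y ≡ᵇ suc x then (x ∷ y ∷ ys) ∷ rs else [ x ] ∷ (y ∷ ys) ∷ rs

runs : List ℕ → List (List ℕ)
runs [] = []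
runs (x ∷ xs) = consRun x (runs xs)

blocks : List ℕ → List (List ℕ)
blocks = runs

complement : ℕ → List ℕ → List ℕ
complement n T = filter (λ i → ¬? (i ∈? T)) [ n ]ₙ

gaps : ℕ → List ℕ → List (List ℕ)
gaps n T = runs (complement n T)

secondGapSize : ℕ → List ℕ → Maybe ℕ
secondGapSize n T with gaps n T
... | _ ∷ g ∷ _ = just (length g)
... | _ = nothing

IsThreshold : ℕ → ℕ → (List ℕ → Set) → Set
IsThreshold n k IsBasis =
  ∃ λ (w : ℕ → ℚ) → ∀ (B : List ℕ) → IsKSubset n k B →
    (IsBasis B ⇔ (0ℚ <ℚ sum′ w B))
  where
  sum′ : (ℕ → ℚ) → List ℕ → ℚ
  sum′ w [] = 0ℚ
  sum′ w (b ∷ bs) = w b +ℚ sum′ w bs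

{-# OPTIONS --safe #-}
module Submission where

open import Defs
open import Data.Nat.Properties
open import Algebra.Properties.CommutativeSemigroup +-commutativeSemigroup using (interchange)
open import Data.Bool using (true; false)
open import Data.Integer as ℤ using (0ℤ; _⊖_)
import Data.Integer.Properties as ℤₚ
import Data.Integer.Tactic.RingSolver as ℤ-Solver
open import Data.List using (List; []; _∷_; [_]; _++_; length; map; head; filter; applyUpTo)
open import Data.List.Membership.DecPropositional _≟_ using (_∈_; _∉_; _∈?_)
open import Data.List.Membership.Propositional.Properties using (∈-++⁺ˡ; ∈-++⁺ʳ; ∈-++⁻)
open import Data.List.Properties
  using (++-identityʳ; length-++; map-upTo; filter-all; filter-none; filter-++)
open import Data.List.Relation.Binary.Pointwise using (Pointwise; []; _∷_)
open import Data.List.Relation.Unary.All as All using (All; []; _∷_)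
open import Data.List.Relation.Unary.All.Properties using (++⁺; all-filter)
import Data.List.Relation.Unary.AllPairs as AllPairs
open import Data.List.Relation.Unary.Any using (here)
open import Data.List.Relation.Unary.Linked as Linked using (Linked; []; [-]; _∷_)
open import Data.List.Relation.Unary.Linked.Properties using (Linked⇒AllPairs; Linked⇒All)
open import Data.Maybe using (just)
open import Data.Maybe.Properties using (just-injective)
open import Data.Nat
open import Data.Nat.ListAction using (sum)
open import Data.Nat.Tactic.RingSolver using (solve-∀)
open import Data.Product using (_×_; _,_; ∃; ∃₂; proj₁; proj₂)
open import Data.Product.Function.NonDependent.Propositional using (_×-⇔_)
open import Data.Rational as ℚ using (ℚ; 0ℚ; *<*)
import Data.Rational.Properties as ℚₚ
open import Data.Rational.Literals using (fromℤ)
import Data.Rational.Unnormalised as ℚᵘ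
import Data.Rational.Unnormalised.Properties as ℚᵘₚ
open import Data.Sum using (_⊎_; inj₁; inj₂; [_,_]′)
open import Function using (_∘_)
open import Function.Bundles using (_⇔_; mk⇔)
open import Function.Properties.Equivalence using (⇔-setoid)
  renaming (refl to ⇔-refl; trans to ⇔-trans)
open import Level using (0ℓ)
open import Relation.Binary.PropositionalEquality hiding ([_])
open import Relation.Nullary using (yes; no; contradiction; ¬?)
open import Relation.Nullary.Decidable using (dec-true; dec-false)
open import Relation.Unary using (Decidable)

-- Write T = A ∪ B ∪ C as three runs ending at e₁ < e₂ < e₃ and, for a
-- k-subset S, let Xⱼ be the number of elements of S that are ≤ eⱼ.  For
-- increasing words of equal length, S ≤ T componentwise iff every initial
-- segment [1, m] contains at least as many elements of S as of T; since T
-- gains one element per step inside a run while S gains at most one, it is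
-- enough to look at m = e₁, e₂, e₃.  So S is a basis iff X₁ ≥ |A|,
-- X₂ ≥ |A| + |B| and X₃ = k.  A second gap of size one means e₂ = e₁ + |B| + 1,
-- hence X₁ ≤ X₂ ≤ X₁ + |B| + 1, and under this constraint the first two
-- conditions together say exactly X₁ + (|B| + 1) X₂ ≥ |A| + (|B| + 1)(|A| + |B|).
-- Giving X₃ a coefficient larger than the range of the left-hand side merges
-- this with X₃ = k into a single inequality, linear in the indicator
-- functions of [1, eⱼ]; that is a threshold presentation.

private
  variable
    m m′ x : ℕ
    xs : List ℕ

linked⇒head<tail : Linked _<_ (x ∷ xs) → All (x <_) xs
linked⇒head<tail xs↑ = AllPairs.head (Linked⇒AllPairs <-trans xs↑)

-- Gale order via counting functions

count≤ : ℕ → List ℕ → ℕ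
count≤ m []       = 0
count≤ m (x ∷ xs) with x ≤? m
... | yes _ = suc (count≤ m xs)
... | no  _ = count≤ m xs

count≤-accept : x ≤ m → count≤ m (x ∷ xs) ≡ suc (count≤ m xs)
count≤-accept {x} {m} x≤m with x ≤? m
... | yes _   = refl
... | no  x≰m = contradiction x≤m x≰m

count≤-reject : m < x → count≤ m (x ∷ xs) ≡ count≤ m xs
count≤-reject {m} {x} m<x with x ≤? m
... | yes x≤m = contradiction x≤m (<⇒≱ m<x)
... | no  _   = refl

count≤-∷-≤ : ∀ m x xs → count≤ m (x ∷ xs) ≤ suc (count≤ m xs)
count≤-∷-≤ m x xs with x ≤? m
... | yes _ = ≤-refl
... | no  _ = n≤1+n _

count≤-++ : ∀ m xs ys → count≤ m (xs ++ ys) ≡ count≤ m xs + count≤ m ys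
count≤-++ m []       ys = refl
count≤-++ m (x ∷ xs) ys with x ≤? m
... | yes _ = cong suc (count≤-++ m xs ys)
... | no  _ = count≤-++ m xs ys

count≤-≤-length : ∀ m xs → count≤ m xs ≤ length xs
count≤-≤-length m []       = z≤n
count≤-≤-length m (x ∷ xs) = ≤-trans (count≤-∷-≤ m x xs) (s≤s (count≤-≤-length m xs))

count≤-none : All (m <_) xs → count≤ m xs ≡ 0
count≤-none []           = refl
count≤-none (m<x ∷ m<xs) = trans (count≤-reject m<x) (count≤-none m<xs)

count≤-all : All (_≤ m) xs → count≤ m xs ≡ length xs
count≤-all []           = refl
count≤-all (x≤m ∷ xs≤m) = trans (count≤-accept x≤m) (cong suc (count≤-all xs≤m))

count≤-mono : m ≤ m′ → ∀ xs → count≤ m xs ≤ count≤ m′ xs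
count≤-mono m≤m′ []       = z≤n
count≤-mono {m} {m′} m≤m′ (x ∷ xs) with x ≤? m | x ≤? m′
... | yes _   | yes _    = s≤s (count≤-mono m≤m′ xs)
... | yes x≤m | no  x≰m′ = contradiction (≤-trans x≤m m≤m′) x≰m′
... | no  _   | yes _    = m≤n⇒m≤1+n (count≤-mono m≤m′ xs)
... | no  _   | no  _    = count≤-mono m≤m′ xs

count≤-suc : Linked _<_ xs → count≤ (suc m) xs ≤ suc (count≤ m xs)
count≤-suc {[]}     _   = z≤n
count≤-suc {x ∷ xs} {m} xs↑ with x ≤? m
... | yes x≤m = begin
  count≤ (suc m) (x ∷ xs) ≡⟨ count≤-accept (m≤n⇒m≤1+n x≤m) ⟩
  suc (count≤ (suc m) xs) ≤⟨ s≤s (count≤-suc (Linked.tail xs↑)) ⟩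
  suc (suc (count≤ m xs)) ∎
  where open ≤-Reasoning
... | no  x≰m = begin
  count≤ (suc m) (x ∷ xs) ≤⟨ count≤-∷-≤ (suc m) x xs ⟩
  suc (count≤ (suc m) xs) ≡⟨ cong suc xs-uncounted ⟩
  1                       ≤⟨ s≤s z≤n ⟩
  suc (count≤ m xs)       ∎
  where
  open ≤-Reasoning
  xs-uncounted : count≤ (suc m) xs ≡ 0
  xs-uncounted = count≤-none (All.map (≤-<-trans (≰⇒> x≰m)) (linked⇒head<tail xs↑))

count≤-lipschitz : Linked _<_ xs → ∀ m d → count≤ (m + d) xs ≤ count≤ m xs + d
count≤-lipschitz {xs} xs↑ m zero    = ≤-reflexive (begin-equality
  count≤ (m + 0) xs ≡⟨ cong (λ m → count≤ m xs) (+-identityʳ m) ⟩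
  count≤ m xs       ≡⟨ +-identityʳ _ ⟨
  count≤ m xs + 0   ∎)
  where open ≤-Reasoning
count≤-lipschitz {xs} xs↑ m (suc d) = begin
  count≤ (m + suc d) xs   ≡⟨ cong (λ m → count≤ m xs) (+-suc m d) ⟩
  count≤ (suc (m + d)) xs ≤⟨ count≤-suc xs↑ ⟩
  suc (count≤ (m + d) xs) ≤⟨ s≤s (count≤-lipschitz xs↑ m d) ⟩
  suc (count≤ m xs + d)   ≡⟨ +-suc _ d ⟨
  count≤ m xs + suc d     ∎
  where open ≤-Reasoning

pointwise⇒count≤-≥ : ∀ {S T} → Pointwise _≤_ S T → ∀ m → count≤ m T ≤ count≤ m S
pointwise⇒count≤-≥ []                                m = z≤n
pointwise⇒count≤-≥ {s ∷ S} {t ∷ T} (s≤t ∷ S≤T) m with s ≤? m | t ≤? m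
... | yes _   | yes _   = s≤s (pointwise⇒count≤-≥ S≤T m)
... | yes _   | no  _   = m≤n⇒m≤1+n (pointwise⇒count≤-≥ S≤T m)
... | no  s≰m | yes t≤m = contradiction (≤-trans s≤t t≤m) s≰m
... | no  _   | no  _   = pointwise⇒count≤-≥ S≤T m

count≤-≥⇒pointwise : ∀ {S T} → Linked _<_ S → Linked _<_ T → length S ≡ length T →
                     (∀ m → count≤ m T ≤ count≤ m S) → Pointwise _≤_ S T
count≤-≥⇒pointwise {[]}    {[]}    _  _  _       _   = []
count≤-≥⇒pointwise {s ∷ S} {t ∷ T} S↑ T↑ |S|≡|T| T≼S =
  s≤t ∷ count≤-≥⇒pointwise (Linked.tail S↑) (Linked.tail T↑) (suc-injective |S|≡|T|) T≼S-tail
  where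
  s≤t : s ≤ t
  s≤t with s ≤? t
  ... | yes s≤t = s≤t
  ... | no  s≰t = contradiction (subst₂ _≤_ T-counted S-uncounted (T≼S t)) λ ()
    where
    T-counted : count≤ t (t ∷ T) ≡ suc (count≤ t T)
    T-counted = count≤-accept (≤-refl {t})
    S-uncounted : count≤ t (s ∷ S) ≡ 0
    S-uncounted = count≤-none (Linked⇒All <-trans (≰⇒> s≰t) S↑)

  T≼S-tail : ∀ m → count≤ m T ≤ count≤ m S
  T≼S-tail m with t ≤? m
  ... | yes t≤m =
    s≤s⁻¹ (subst₂ _≤_ (count≤-accept t≤m) (count≤-accept (≤-trans s≤t t≤m)) (T≼S m))
  ... | no  t≰m = ≤-trans (≤-reflexive T-uncounted) z≤n
    where
    T-uncounted : count≤ m T ≡ 0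
    T-uncounted = count≤-none (All.map (<-trans (≰⇒> t≰m)) (linked⇒head<tail T↑))

run : ℕ → ℕ → List ℕ
run x zero    = []
run x (suc l) = x ∷ run (suc x) l

length-run : ∀ x l → length (run x l) ≡ l
length-run x zero    = refl
length-run x (suc l) = cong suc (length-run (suc x) l)

run-bounds : ∀ x l → All (λ i → x ≤ i × i < x + l) (run x l)
run-bounds x zero    = []
run-bounds x (suc l) = (≤-refl , m<m+n x z<s) ∷ All.map shift (run-bounds (suc x) l)
  where
  shift : ∀ {i} → suc x ≤ i × i < suc x + l → x ≤ i × i < x + suc l
  shift {i} (x<i , i<1+x+l) = <⇒≤ x<i , subst (i <_) (sym (+-suc x l)) i<1+x+l

run-linked : ∀ x l → Linked _<_ (run x l)
run-linked x zero          = []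
run-linked x (suc zero)    = [-]
run-linked x (suc (suc l)) = n<1+n x ∷ run-linked (suc x) (suc l)

run-++-linked : ∀ x p {U} → All (x + p <_) U → Linked _<_ U → Linked _<_ (run x (suc p) ++ U)
run-++-linked x zero    []          _  = [-]
run-++-linked x zero    (x+0<u ∷ _) U↑ = subst (_< _) (+-identityʳ x) x+0<u ∷ U↑
run-++-linked x (suc p) {U} U>x+1+p U↑ =
  n<1+n x ∷ run-++-linked (suc x) p (subst (λ y → All (y <_) U) (+-suc x p) U>x+1+p) U↑

run-++ : ∀ x a b → run x (a + b) ≡ run x a ++ run (x + a) b
run-++ x zero    b = cong (λ y → run y b) (sym (+-identityʳ x))
run-++ x (suc a) b = cong (x ∷_) (begin
  run (suc x) (a + b)                  ≡⟨ run-++ (suc x) a b ⟩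
  run (suc x) a ++ run (suc x + a) b   ≡⟨ cong (λ y → run (suc x) a ++ run y b) (+-suc x a) ⟨
  run (suc x) a ++ run (x + suc a) b   ∎)
  where open ≡-Reasoning

count≤-run-full : ∀ x l → x + l ≤ suc m → count≤ m (run x l) ≡ l
count≤-run-full x l x+l≤1+m = trans (count≤-all (All.map below (run-bounds x l))) (length-run x l)
  where
  below : ∀ {i} → x ≤ i × i < x + l → i ≤ _
  below (_ , i<x+l) = s≤s⁻¹ (<-≤-trans i<x+l x+l≤1+m)

count≤-run-partial : ∀ x l → m < x + l → count≤ m (run x l) ≡ suc m ∸ x
count≤-run-partial {m} x zero    m<x   = sym (m≤n⇒m∸n≡0 (subst (m <_) (+-identityʳ x) m<x))
count≤-run-partial {m} x (suc l) m<x+l with x ≤? m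
... | yes x≤m = trans (cong suc (count≤-run-partial (suc x) l (subst (m <_) (+-suc x l) m<x+l)))
                      (sym (+-∸-assoc 1 x≤m))
... | no  x≰m =
  trans (count≤-none (All.map (λ (x<i , _) → <-trans (≰⇒> x≰m) x<i) (run-bounds (suc x) l)))
        (sym (m≤n⇒m∸n≡0 (≰⇒> x≰m)))

-- b stands for the number of elements of T lying in the runs before x, …, x + p.
module _ {S : List ℕ} (S↑ : Linked _<_ S) {x p b : ℕ} (ends : b + suc p ≤ count≤ (x + p) S) where

  count≤-within-run : b ≤ count≤ m S → m < x + p → b + (suc m ∸ x) ≤ count≤ m S
  count≤-within-run {m} b≤ m<x+p with x ≤? suc m
  ... | no  x≰1+m = begin
    b + (suc m ∸ x) ≡⟨ cong (b +_) (m≤n⇒m∸n≡0 (<⇒≤ (≰⇒> x≰1+m))) ⟩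
    b + 0           ≡⟨ +-identityʳ b ⟩
    b               ≤⟨ b≤ ⟩
    count≤ m S      ∎
    where open ≤-Reasoning
  ... | yes x≤1+m = +-cancelʳ-≤ d (b + a) (count≤ m S) (begin
    b + a + d        ≡⟨ +-assoc b a d ⟩
    b + (a + d)      ≡⟨ cong (b +_) a+d≡1+p ⟩
    b + suc p        ≤⟨ ends ⟩
    count≤ (x + p) S ≡⟨ cong (λ y → count≤ y S) m+d≡x+p ⟨
    count≤ (m + d) S ≤⟨ count≤-lipschitz S↑ m d ⟩
    count≤ m S + d   ∎)
    where
    open ≤-Reasoning
    a d : ℕ
    a = suc m ∸ x
    d = x + p ∸ m
    m+d≡x+p : m + d ≡ x + p
    m+d≡x+p = m+[n∸m]≡n (<⇒≤ m<x+p)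
    a+d≡1+p : a + d ≡ suc p
    a+d≡1+p = +-cancelˡ-≡ x (a + d) (suc p) (begin-equality
      x + (a + d) ≡⟨ +-assoc x a d ⟨
      x + a + d   ≡⟨ cong (_+ d) (m+[n∸m]≡n x≤1+m) ⟩
      suc (m + d) ≡⟨ cong suc m+d≡x+p ⟩
      suc (x + p) ≡⟨ +-suc x p ⟨
      x + suc p   ∎)

  count≤-run-++-≤ : ∀ {U m} → All (x + p <_) U →
                    (x + p ≤ m → b + suc p + count≤ m U ≤ count≤ m S) →
                    b ≤ count≤ m S → b + count≤ m (run x (suc p) ++ U) ≤ count≤ m S
  count≤-run-++-≤ {U} {m} U>x+p beyond b≤ with x + p ≤? m
  ... | yes x+p≤m = begin
    b + count≤ m (R ++ U)           ≡⟨ cong (b +_) (count≤-++ m R U) ⟩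
    b + (count≤ m R + count≤ m U)   ≡⟨ cong (λ c → b + (c + count≤ m U)) R-full ⟩
    b + (suc p + count≤ m U)        ≡⟨ +-assoc b (suc p) _ ⟨
    b + suc p + count≤ m U          ≤⟨ beyond x+p≤m ⟩
    count≤ m S                      ∎
    where
    open ≤-Reasoning
    R = run x (suc p)
    R-full : count≤ m R ≡ suc p
    R-full = count≤-run-full x (suc p) (subst (_≤ suc m) (sym (+-suc x p)) (s≤s x+p≤m))
  ... | no  x+p≰m = begin
    b + count≤ m (R ++ U)           ≡⟨ cong (b +_) (count≤-++ m R U) ⟩
    b + (count≤ m R + count≤ m U)   ≡⟨ cong₂ (λ c c′ → b + (c + c′)) R-partial U-uncounted ⟩
    b + (suc m ∸ x + 0)             ≡⟨ cong (b +_) (+-identityʳ _) ⟩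
    b + (suc m ∸ x)                 ≤⟨ count≤-within-run b≤ m<x+p ⟩
    count≤ m S                      ∎
    where
    open ≤-Reasoning
    R = run x (suc p)
    m<x+p : m < x + p
    m<x+p = ≰⇒> x+p≰m
    R-partial : count≤ m R ≡ suc m ∸ x
    R-partial = count≤-run-partial x (suc p) (<-≤-trans m<x+p (+-monoʳ-≤ x (n≤1+n p)))
    U-uncounted : count≤ m U ≡ 0
    U-uncounted = count≤-none (All.map (<-trans m<x+p) U>x+p)

  count≤-run-≤ : b ≤ count≤ m S → b + count≤ m (run x (suc p)) ≤ count≤ m S
  count≤-run-≤ {m} b≤ =
    subst (λ R → b + count≤ m R ≤ count≤ m S) (++-identityʳ (run x (suc p)))
          (count≤-run-++-≤ [] beyond b≤)
    where
    beyond : x + p ≤ m → b + suc p + 0 ≤ count≤ m S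
    beyond x+p≤m =
      subst (_≤ count≤ m S) (sym (+-identityʳ _)) (≤-trans ends (count≤-mono x+p≤m S))

module ThreeBlocks (x₁ p₁ x₂ p₂ x₃ p₃ : ℕ)
                   (sep₁ : x₁ + suc p₁ ≤ x₂) (sep₂ : x₂ + suc p₂ ≤ x₃) where

  T : List ℕ
  T = run x₁ (suc p₁) ++ run x₂ (suc p₂) ++ run x₃ (suc p₃)

  e₁ e₂ e₃ : ℕ
  e₁ = x₁ + p₁
  e₂ = x₂ + p₂
  e₃ = x₃ + p₃

  private
    end<next : ∀ x p {y} → x + suc p ≤ y → x + p < y
    end<next x p = ≤-trans (≤-reflexive (sym (+-suc x p)))

    run-after : ∀ {e} x l → e < x → All (e <_) (run x l)
    run-after x l e<x = All.map (λ (x≤i , _) → <-≤-trans e<x x≤i) (run-bounds x l)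

    ends-at : ∀ x p → x + suc p ≤ suc (x + p)
    ends-at x p = ≤-reflexive (+-suc x p)

    ends-before : ∀ {y} x p → y ≤ x → y ≤ suc (x + p)
    ends-before x p y≤x = ≤-trans y≤x (≤-trans (m≤m+n x p) (n≤1+n _))

    e₁<x₂ : e₁ < x₂
    e₁<x₂ = end<next x₁ p₁ sep₁

    e₂<x₃ : e₂ < x₃
    e₂<x₃ = end<next x₂ p₂ sep₂

    x₂≤x₃ : x₂ ≤ x₃
    x₂≤x₃ = ≤-trans (m≤m+n x₂ (suc p₂)) sep₂

    e₁<x₃ : e₁ < x₃
    e₁<x₃ = <-≤-trans e₁<x₂ x₂≤x₃

    after-e₁ : All (e₁ <_) (run x₂ (suc p₂) ++ run x₃ (suc p₃))
    after-e₁ = ++⁺ (run-after x₂ (suc p₂) e₁<x₂) (run-after x₃ (suc p₃) e₁<x₃)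

    after-e₂ : All (e₂ <_) (run x₃ (suc p₃))
    after-e₂ = run-after x₃ (suc p₃) e₂<x₃

  length-T : length T ≡ suc p₁ + (suc p₂ + suc p₃)
  length-T = begin
    length T
      ≡⟨ length-++ (run x₁ (suc p₁)) ⟩
    length (run x₁ (suc p₁)) + length (run x₂ (suc p₂) ++ run x₃ (suc p₃))
      ≡⟨ cong (length (run x₁ (suc p₁)) +_) (length-++ (run x₂ (suc p₂))) ⟩
    length (run x₁ (suc p₁)) + (length (run x₂ (suc p₂)) + length (run x₃ (suc p₃)))
      ≡⟨ cong₂ _+_ (length-run x₁ (suc p₁)) (cong₂ _+_ (length-run x₂ (suc p₂)) (length-run x₃ _)) ⟩
    suc p₁ + (suc p₂ + suc p₃)
      ∎
    where open ≡-Reasoning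

  T-linked : Linked _<_ T
  T-linked = run-++-linked x₁ p₁ after-e₁ (run-++-linked x₂ p₂ after-e₂ (run-linked x₃ (suc p₃)))

  count≤-T : ∀ m → count≤ m T ≡
    count≤ m (run x₁ (suc p₁)) + (count≤ m (run x₂ (suc p₂)) + count≤ m (run x₃ (suc p₃)))
  count≤-T m = trans (count≤-++ m (run x₁ (suc p₁)) _)
                     (cong (count≤ m (run x₁ (suc p₁)) +_) (count≤-++ m (run x₂ (suc p₂)) _))

  count≤-e₁ : count≤ e₁ T ≡ suc p₁
  count≤-e₁ = begin
    count≤ e₁ T  ≡⟨ count≤-T e₁ ⟩
    _            ≡⟨ cong₂ _+_ (count≤-run-full x₁ (suc p₁) (ends-at x₁ p₁))
                     (cong₂ _+_ (count≤-none (run-after x₂ (suc p₂) e₁<x₂))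
                                (count≤-none (run-after x₃ (suc p₃) e₁<x₃))) ⟩
    suc p₁ + 0   ≡⟨ +-identityʳ _ ⟩
    suc p₁       ∎
    where open ≡-Reasoning

  count≤-e₂ : count≤ e₂ T ≡ suc p₁ + suc p₂
  count≤-e₂ = begin
    count≤ e₂ T            ≡⟨ count≤-T e₂ ⟩
    _                      ≡⟨ cong₂ _+_ (count≤-run-full x₁ (suc p₁) (ends-before x₂ p₂ sep₁))
                               (cong₂ _+_ (count≤-run-full x₂ (suc p₂) (ends-at x₂ p₂))
                                          (count≤-none (run-after x₃ (suc p₃) e₂<x₃))) ⟩
    suc p₁ + (suc p₂ + 0)  ≡⟨ cong (suc p₁ +_) (+-identityʳ _) ⟩
    suc p₁ + suc p₂        ∎
    where open ≡-Reasoning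

  count≤-e₃ : count≤ e₃ T ≡ length T
  count≤-e₃ = begin
    count≤ e₃ T                 ≡⟨ count≤-T e₃ ⟩
    _                           ≡⟨ cong₂ _+_
                                     (count≤-run-full x₁ (suc p₁) (ends-before x₃ p₃ (≤-trans sep₁ x₂≤x₃)))
                                     (cong₂ _+_ (count≤-run-full x₂ (suc p₂) (ends-before x₃ p₃ sep₂))
                                                (count≤-run-full x₃ (suc p₃) (ends-at x₃ p₃))) ⟩
    suc p₁ + (suc p₂ + suc p₃)  ≡⟨ length-T ⟨
    length T                    ∎
    where open ≡-Reasoning

  dominated-by-ends : ∀ {S} → Linked _<_ S →
    suc p₁ ≤ count≤ e₁ S → suc p₁ + suc p₂ ≤ count≤ e₂ S → length T ≤ count≤ e₃ S →
    ∀ m → count≤ m T ≤ count≤ m S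
  dominated-by-ends {S} S↑ h₁ h₂ h₃ m =
    count≤-run-++-≤ S↑ {x₁} {p₁} {0} h₁ after-e₁
      (λ e₁≤m → count≤-run-++-≤ S↑ {x₂} {p₂} {suc p₁} h₂ after-e₂
        (λ e₂≤m → count≤-run-≤ S↑ {x₃} {p₃} {suc p₁ + suc p₂} h₃′
                    (≤-trans h₂ (count≤-mono e₂≤m S)))
        (≤-trans h₁ (count≤-mono e₁≤m S)))
      z≤n
    where
    h₃′ : suc p₁ + suc p₂ + suc p₃ ≤ count≤ e₃ S
    h₃′ = subst (_≤ count≤ e₃ S) (trans length-T (sym (+-assoc (suc p₁) _ _))) h₃

  pointwise⇔ends : ∀ {S} → Linked _<_ S → length S ≡ length T →
    Pointwise _≤_ S T ⇔
    (suc p₁ ≤ count≤ e₁ S × suc p₁ + suc p₂ ≤ count≤ e₂ S × length T ≤ count≤ e₃ S)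
  pointwise⇔ends {S} S↑ |S|≡|T| = mk⇔
    (λ S≤T → let at e = pointwise⇒count≤-≥ S≤T e in
      subst (_≤ count≤ e₁ S) count≤-e₁ (at e₁) ,
      subst (_≤ count≤ e₂ S) count≤-e₂ (at e₂) ,
      subst (_≤ count≤ e₃ S) count≤-e₃ (at e₃))
    (λ (h₁ , h₂ , h₃) →
      count≤-≥⇒pointwise S↑ T-linked |S|≡|T| (dominated-by-ends S↑ h₁ h₂ h₃))

-- Linear threshold inequalities

two-thresholds⇔weighted : ∀ {P q X₁ X₂} → X₁ ≤ X₂ → X₂ ≤ X₁ + suc q →
  (P ≤ X₁ × P + q ≤ X₂) ⇔ (P + suc q * (P + q) ≤ X₁ + suc q * X₂)
two-thresholds⇔weighted {P} {q} {X₁} {X₂} X₁≤X₂ X₂≤X₁+1+q = mk⇔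
  (λ (P≤X₁ , P+q≤X₂) → +-mono-≤ P≤X₁ (*-monoʳ-≤ (suc q) P+q≤X₂))
  (λ D≤F → P≤X₁ D≤F , P+q≤X₂ D≤F)
  where
  D F : ℕ
  D = P + suc q * (P + q)
  F = X₁ + suc q * X₂

  P≤X₁ : D ≤ F → P ≤ X₁
  P≤X₁ D≤F with P ≤? X₁
  ... | yes P≤X₁ = P≤X₁
  ... | no  P≰X₁ = contradiction D≤F (<⇒≱ (+-mono-<-≤ X₁<P (*-monoʳ-≤ (suc q) X₂≤P+q)))
    where
    X₁<P : X₁ < P
    X₁<P = ≰⇒> P≰X₁
    X₂≤P+q : X₂ ≤ P + q
    X₂≤P+q = ≤-trans X₂≤X₁+1+q (≤-trans (≤-reflexive (+-suc X₁ q)) (+-monoˡ-≤ q X₁<P))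

  P+q≤X₂ : D ≤ F → P + q ≤ X₂
  P+q≤X₂ D≤F with P + q ≤? X₂
  ... | yes P+q≤X₂ = P+q≤X₂
  ... | no  P+q≰X₂ = contradiction D≤F (<⇒≱ (+-cancelʳ-≤ q (suc F) D (begin
    suc F + q               ≡⟨ shift X₁ X₂ q ⟩
    X₁ + suc q * suc X₂     ≤⟨ +-monoʳ-≤ X₁ (*-monoʳ-≤ (suc q) X₂<P+q) ⟩
    X₁ + suc q * (P + q)    ≤⟨ +-monoˡ-≤ (suc q * (P + q)) (≤-trans X₁≤X₂ (<⇒≤ X₂<P+q)) ⟩
    P + q + suc q * (P + q) ≡⟨ regroup P q ⟩
    D + q                   ∎)))
    where
    open ≤-Reasoning
    X₂<P+q : X₂ < P + q
    X₂<P+q = ≰⇒> P+q≰X₂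
    shift : ∀ a b q → suc (a + suc q * b) + q ≡ a + suc q * suc b
    shift = solve-∀
    regroup : ∀ P q → P + q + suc q * (P + q) ≡ P + suc q * (P + q) + q
    regroup = solve-∀

lexicographic-≤ : ∀ {M k D X F} → X ≤ k → F ≤ M →
  (D ≤ F × k ≤ X) ⇔ (suc M * k + D ≤ suc M * X + F)
lexicographic-≤ {M} {k} {D} {X} {F} X≤k F≤M = mk⇔
  (λ (D≤F , k≤X) → +-mono-≤ (*-monoʳ-≤ (suc M) k≤X) D≤F)
  (λ H → let X≡k = ≤-antisym X≤k (k≤X H) in
    +-cancelˡ-≤ (suc M * k) D F (subst (λ y → suc M * k + D ≤ suc M * y + F) X≡k H) , k≤X H)
  where
  k≤X : suc M * k + D ≤ suc M * X + F → k ≤ X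
  k≤X H with k ≤? X
  ... | yes k≤X = k≤X
  ... | no  k≰X = contradiction H (<⇒≱ (begin-strict
    suc M * X + F     <⟨ +-monoʳ-< (suc M * X) (s≤s F≤M) ⟩
    suc M * X + suc M ≡⟨ +-comm (suc M * X) (suc M) ⟩
    suc M + suc M * X ≡⟨ *-suc (suc M) X ⟨
    suc M * suc X     ≤⟨ *-monoʳ-≤ (suc M) (≰⇒> k≰X) ⟩
    suc M * k         ≤⟨ m≤m+n (suc M * k) D ⟩
    suc M * k + D     ∎))
    where open ≤-Reasoning

sum-map-+ : ∀ {A : Set} (f g : A → ℕ) xs →
  sum (map (λ i → f i + g i) xs) ≡ sum (map f xs) + sum (map g xs)
sum-map-+ f g []       = refl
sum-map-+ f g (x ∷ xs) = trans (cong (f x + g x +_) (sum-map-+ f g xs)) (interchange (f x) (g x) _ _)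

sum-map-* : ∀ {A : Set} a (f : A → ℕ) xs → sum (map (λ i → a * f i) xs) ≡ a * sum (map f xs)
sum-map-* a f []       = sym (*-zeroʳ a)
sum-map-* a f (x ∷ xs) = trans (cong (a * f x +_) (sum-map-* a f xs)) (sym (*-distribˡ-+ a (f x) _))

sum-map-count≤ : ∀ m xs → sum (map (λ i → count≤ m [ i ]) xs) ≡ count≤ m xs
sum-map-count≤ m []       = refl
sum-map-count≤ m (x ∷ xs) =
  trans (cong (count≤ m [ x ] +_) (sum-map-count≤ m xs)) (sym (count≤-++ m [ x ] xs))

fromℤ-+ : ∀ i j → fromℤ (i ℤ.+ j) ≡ fromℤ i ℚ.+ fromℤ j
fromℤ-+ i j = ℚₚ.toℚᵘ-injective (ℚᵘₚ.≃-trans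
  (ℚᵘ.*≡* (cong₂ (λ a b → (a ℤ.+ b) ℤ.* ℤ.+ 1)
                  (sym (ℤₚ.*-identityʳ i)) (sym (ℤₚ.*-identityʳ j))))
  (ℚᵘₚ.≃-sym (ℚₚ.toℚᵘ-homo-+ (fromℤ i) (fromℤ j))))

fromℤ-positive : ∀ z → (0ℚ ℚ.< fromℤ z) ⇔ (0ℤ ℤ.< z)
fromℤ-positive z = mk⇔
  (λ { (*<* 0<z*1) → subst (0ℤ ℤ.<_) (ℤₚ.*-identityʳ z) 0<z*1 })
  (λ 0<z → *<* (subst (0ℤ ℤ.<_) (sym (ℤₚ.*-identityʳ z)) 0<z))

⊖-positive : ∀ m n → (0ℤ ℤ.< m ⊖ n) ⇔ (n < m)
⊖-positive m n = mk⇔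
  (λ 0<m⊖n → ≰⇒> (λ m≤n → ℤₚ.<⇒≱ 0<m⊖n (m⊖n≤0 m≤n)))
  (λ n<m → subst (ℤ._< m ⊖ n) (ℤₚ.n⊖n≡0 n) (ℤₚ.⊖-monoˡ-< n n<m))
  where
  m⊖n≤0 : m ≤ n → m ⊖ n ℤ.≤ 0ℤ
  m⊖n≤0 m≤n = subst (m ⊖ n ℤ.≤_) (ℤₚ.n⊖n≡0 n) (ℤₚ.⊖-monoˡ-≤ n m≤n)

⊖-+-⊖ : ∀ a c s l → (a ⊖ c) ℤ.+ (s ⊖ l) ≡ (a + s) ⊖ (c + l)
⊖-+-⊖ a c s l = begin
  (a ⊖ c) ℤ.+ (s ⊖ l)
    ≡⟨ cong₂ ℤ._+_ (ℤₚ.[+m]-[+n]≡m⊖n a c) (ℤₚ.[+m]-[+n]≡m⊖n s l) ⟨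
  (ℤ.+ a ℤ.- ℤ.+ c) ℤ.+ (ℤ.+ s ℤ.- ℤ.+ l)  ≡⟨ regroup (ℤ.+ a) (ℤ.+ c) (ℤ.+ s) (ℤ.+ l) ⟩
  (ℤ.+ a ℤ.+ ℤ.+ s) ℤ.- (ℤ.+ c ℤ.+ ℤ.+ l)  ≡⟨ cong₂ ℤ._-_ (ℤₚ.pos-+ a s) (ℤₚ.pos-+ c l) ⟨
  ℤ.+ (a + s) ℤ.- ℤ.+ (c + l)               ≡⟨ ℤₚ.[+m]-[+n]≡m⊖n (a + s) (c + l) ⟩
  (a + s) ⊖ (c + l)                         ∎
  where
  open ≡-Reasoning
  regroup : ∀ a c s l → a ℤ.- c ℤ.+ (s ℤ.- l) ≡ a ℤ.+ s ℤ.- (c ℤ.+ l)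
  regroup = ℤ-Solver.solve-∀

-- IsThreshold adds up weights with a function local to its where-block, which
-- cannot be named here; it is abstracted as any Σℚ obeying its two defining
-- equations and recovered by unification in isThreshold-from-ℕ-weights.
module _ (Σℚ : (ℕ → ℚ) → List ℕ → ℚ)
         (Σℚ-[] : ∀ w → Σℚ w [] ≡ 0ℚ)
         (Σℚ-∷ : ∀ w b B → Σℚ w (b ∷ B) ≡ w b ℚ.+ Σℚ w B) where

  Σℚ-fromℤ-⊖ : ∀ g c B → Σℚ (λ i → fromℤ (g i ⊖ c)) B ≡ fromℤ (sum (map g B) ⊖ (length B * c))
  Σℚ-fromℤ-⊖ g c []      = Σℚ-[] _
  Σℚ-fromℤ-⊖ g c (b ∷ B) = begin
    Σℚ w (b ∷ B)                                ≡⟨ Σℚ-∷ w b B ⟩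
    w b ℚ.+ Σℚ w B                              ≡⟨ cong (w b ℚ.+_) (Σℚ-fromℤ-⊖ g c B) ⟩
    fromℤ (g b ⊖ c) ℚ.+ fromℤ (s ⊖ l)          ≡⟨ fromℤ-+ (g b ⊖ c) (s ⊖ l) ⟨
    fromℤ ((g b ⊖ c) ℤ.+ (s ⊖ l))              ≡⟨ cong fromℤ (⊖-+-⊖ (g b) c s l) ⟩
    fromℤ ((g b + s) ⊖ (c + l))                 ∎
    where
    open ≡-Reasoning
    w : ℕ → ℚ
    w i = fromℤ (g i ⊖ c)
    s l : ℕ
    s = sum (map g B)
    l = length B * c

  -- Subtracting c / k from every weight turns c < Σ g into positivity on
  -- k-subsets; everything is scaled by k to keep the weights integral.
  ∃-threshold-weights : ∀ {n k} .{{_ : NonZero k}} {IsBasis : List ℕ → Set} (g : ℕ → ℕ) (c : ℕ) →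
    (∀ B → IsKSubset n k B → IsBasis B ⇔ (c < sum (map g B))) →
    ∃ λ w → ∀ B → IsKSubset n k B → IsBasis B ⇔ (0ℚ ℚ.< Σℚ w B)
  ∃-threshold-weights {n} {k} {IsBasis} g c basis⇔ = w , λ B B-kset@(_ , _ , |B|≡k) → begin
    IsBasis B                                   ≈⟨ basis⇔ B B-kset ⟩
    c < sum (map g B)                           ≈⟨ mk⇔ (*-monoʳ-< k) (*-cancelˡ-< k _ _) ⟩
    k * c < k * sum (map g B)                   ≡⟨ cong₂ _<_ (cong (_* c) (sym |B|≡k)) (sym (sum-map-* k g B)) ⟩
    length B * c < sum (map kg B)               ≈⟨ ⊖-positive _ _ ⟨
    0ℤ ℤ.< sum (map kg B) ⊖ (length B * c)      ≈⟨ fromℤ-positive _ ⟨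
    0ℚ ℚ.< fromℤ (sum (map kg B) ⊖ (length B * c)) ≡⟨ cong (0ℚ ℚ.<_) (Σℚ-fromℤ-⊖ kg c B) ⟨
    0ℚ ℚ.< Σℚ w B                               ∎
    where
    open import Relation.Binary.Reasoning.Setoid (⇔-setoid 0ℓ)
    kg : ℕ → ℕ
    kg i = k * g i
    w : ℕ → ℚ
    w i = fromℤ (kg i ⊖ c)

isThreshold-from-ℕ-weights : ∀ {n k} .{{_ : NonZero k}} {IsBasis : List ℕ → Set} (g : ℕ → ℕ) (c : ℕ) →
  (∀ B → IsKSubset n k B → IsBasis B ⇔ (c < sum (map g B))) → IsThreshold n k IsBasis
isThreshold-from-ℕ-weights = ∃-threshold-weights _ (λ _ → refl) (λ _ _ _ → refl)

-- Blocks and gaps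

runs-∷ : ∀ y ys → ∃₂ λ zs rs → runs (y ∷ ys) ≡ (y ∷ zs) ∷ rs
runs-∷ y ys with runs ys
... | []            = [] , [] , refl
... | [] ∷ rs       = [] , [] ∷ rs , refl
... | (z ∷ zs) ∷ rs with z ≡ᵇ suc y
...   | true  = z ∷ zs , rs , refl
...   | false = [] , (z ∷ zs) ∷ rs , refl

length-runs-∷ : ∀ y ys → length (runs (y ∷ ys)) ≢ 0
length-runs-∷ y ys ≡0 with runs-∷ y ys
... | _ , _ , runs-y∷ys = contradiction (trans (cong length (sym runs-y∷ys)) ≡0) λ ()

≡ᵇ-refl : ∀ n → (n ≡ᵇ n) ≡ true
≡ᵇ-refl n = dec-true (n ≟ n) refl

≢⇒≡ᵇ-false : ∀ {m n} → m ≢ n → (m ≡ᵇ n) ≡ false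
≢⇒≡ᵇ-false {m} {n} = dec-false (m ≟ n)

runs-run-++ : ∀ x p ys → head ys ≢ just (x + suc p) →
  runs (run x (suc p) ++ ys) ≡ run x (suc p) ∷ runs ys
runs-run-++ x zero    []       _  = refl
runs-run-++ x zero    (y ∷ ys) y≢ with runs-∷ y ys
... | _ , _ , runs-y∷ys
  rewrite runs-y∷ys | ≢⇒≡ᵇ-false {y} {suc x} (λ y≡1+x → y≢ (cong just (trans y≡1+x (+-comm 1 x)))) = refl
runs-run-++ x (suc p) ys ys≢
  rewrite runs-run-++ (suc x) p ys (subst (λ v → head ys ≢ just v) (+-suc x (suc p)) ys≢) | ≡ᵇ-refl x = refl

head-≢ : ∀ {v ys} → All (v <_) ys → head ys ≢ just v
head-≢ []        ()
head-≢ (v<y ∷ _) refl = <-irrefl refl v<y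

peel-run : ∀ {x xs} → Linked _<_ (x ∷ xs) →
  ∃₂ λ p ys → x ∷ xs ≡ run x (suc p) ++ ys × Linked _<_ ys × All (x + suc p <_) ys
peel-run {x} {[]}     _             = 0 , [] , refl , [] , []
peel-run {x} {y ∷ xs} (x<y ∷ y∷xs↑) with y ≟ suc x
... | yes refl =
  let p , ys , y∷xs≡ , ys↑ , ys> = peel-run y∷xs↑
  in suc p , ys , cong (x ∷_) y∷xs≡ , ys↑ , subst (λ v → All (v <_) ys) (sym (+-suc x (suc p))) ys>
... | no  y≢1+x = 0 , y ∷ xs , refl , y∷xs↑ , Linked⇒All <-trans x+1<y y∷xs↑
  where
  x+1<y : x + 1 < y
  x+1<y = subst (_< y) (+-comm 1 x) (≤∧≢⇒< x<y (y≢1+x ∘ sym))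

peel-block : ∀ {x xs r} → Linked _<_ (x ∷ xs) → length (runs (x ∷ xs)) ≡ suc r →
  ∃₂ λ p ys → x ∷ xs ≡ run x (suc p) ++ ys × Linked _<_ ys × All (x + suc p <_) ys
              × length (runs ys) ≡ r
peel-block {x} {xs} {r} x∷xs↑ ≡1+r with peel-run x∷xs↑
... | p , ys , x∷xs≡ , ys↑ , ys> = p , ys , x∷xs≡ , ys↑ , ys> , suc-injective (begin
  suc (length (runs ys))              ≡⟨ cong length (runs-run-++ x p ys (head-≢ ys>)) ⟨
  length (runs (run x (suc p) ++ ys)) ≡⟨ cong (length ∘ runs) x∷xs≡ ⟨
  length (runs (x ∷ xs))              ≡⟨ ≡1+r ⟩
  suc r                               ∎)
  where open ≡-Reasoning

record ThreeRuns (T : List ℕ) : Set where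
  field
    x₁ p₁ x₂ p₂ x₃ p₃ : ℕ
    T≡ : T ≡ run x₁ (suc p₁) ++ run x₂ (suc p₂) ++ run x₃ (suc p₃)
    gap₁ : x₁ + suc p₁ < x₂
    gap₂ : x₂ + suc p₂ < x₃

three-runs : ∀ {T} → Linked _<_ T → length (runs T) ≡ 3 → ThreeRuns T
three-runs {x ∷ xs} T↑ ≡3 with peel-block T↑ ≡3
... | p₁ , y ∷ ys , T≡ , ↑₁ , gap₁ ∷ _ , ≡2 with peel-block ↑₁ ≡2
... | p₂ , z ∷ zs , y∷ys≡ , ↑₂ , gap₂ ∷ _ , ≡1 with peel-block ↑₂ ≡1
... | p₃ , w ∷ ws , _     , _ , _ , ≡0 = contradiction ≡0 (length-runs-∷ w ws)
... | p₃ , []     , z∷zs≡ , _ , _ , _  = record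
  { x₁ = x ; p₁ = p₁ ; x₂ = y ; p₂ = p₂ ; x₃ = z ; p₃ = p₃
  ; T≡ = trans T≡ (cong (run x (suc p₁) ++_)
           (trans y∷ys≡ (cong (run y (suc p₂) ++_) (trans z∷zs≡ (++-identityʳ _)))))
  ; gap₁ = gap₁
  ; gap₂ = gap₂
  }

applyUpTo-run : ∀ (f : ℕ → ℕ) x l → (∀ i → f i ≡ x + i) → applyUpTo f l ≡ run x l
applyUpTo-run f x zero    f≗x+ = refl
applyUpTo-run f x (suc l) f≗x+ = cong₂ _∷_ (trans (f≗x+ 0) (+-identityʳ x))
  (applyUpTo-run (f ∘ suc) (suc x) l (λ i → trans (f≗x+ (suc i)) (+-suc x i)))

[_]ₙ≡run : ∀ n → [ n ]ₙ ≡ run 1 n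
[ n ]ₙ≡run = trans (map-upTo suc n) (applyUpTo-run suc 1 n (λ _ → refl))

secondGapSize-gaps : ∀ {n T G₁ G₂ Gs} → gaps n T ≡ G₁ ∷ G₂ ∷ Gs →
                     secondGapSize n T ≡ just (length G₂)
secondGapSize-gaps gaps≡ rewrite gaps≡ = refl

secondGapSize-run-++ : ∀ n {x p y U} → 2 ≤ x → x + suc p < y → y ≤ n → All (y ≤_) U → y ∈ U →
  secondGapSize n (run x (suc p) ++ U) ≡ just (y ∸ (x + suc p))
secondGapSize-run-++ n {x@(suc (suc a))} {p} {y} {U} (s≤s (s≤s z≤n)) e<y y≤n U≥y y∈U
  with g , 1+e+g≡y ← m≤n⇒∃[o]m+o≡n e<y
  with refl ← trans (+-suc (x + suc p) g) 1+e+g≡y = begin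
    secondGapSize n T             ≡⟨ secondGapSize-gaps {n} {T} gaps≡ ⟩
    just (length (run e (suc g))) ≡⟨ cong just (length-run e (suc g)) ⟩
    just (suc g)                  ≡⟨ cong just (m+n∸m≡n e (suc g)) ⟨
    just (e + suc g ∸ e)          ∎
  where
  open ≡-Reasoning
  P e r : ℕ
  P = suc p
  e = x + P
  r = suc n ∸ y
  T : List ℕ
  T = run x P ++ U
  ∉T? : Decidable (_∉ T)
  ∉T? i = ¬? (i ∈? T)
  rest : List ℕ
  rest = filter ∉T? (run y r)

  [n]≡ : [ n ]ₙ ≡ run 1 (suc a) ++ run x P ++ run e (suc g) ++ run y r
  [n]≡ = begin
    [ n ]ₙ                                               ≡⟨ [ n ]ₙ≡run ⟩
    run 1 n                                              ≡⟨ cong (run 1) n≡ ⟩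
    run 1 (suc a + (P + (suc g + r)))                    ≡⟨ run-++ 1 (suc a) _ ⟩
    run 1 (suc a) ++ run x (P + (suc g + r))             ≡⟨ cong (run 1 (suc a) ++_) (run-++ x P _) ⟩
    run 1 (suc a) ++ run x P ++ run e (suc g + r)
      ≡⟨ cong (λ R → run 1 (suc a) ++ run x P ++ R) (run-++ e (suc g) r) ⟩
    run 1 (suc a) ++ run x P ++ run e (suc g) ++ run y r ∎
    where
    reassoc : ∀ a P g r → suc a + P + suc g + r ≡ suc a + (P + (suc g + r))
    reassoc = solve-∀
    n≡ : n ≡ suc a + (P + (suc g + r))
    n≡ = trans (suc-injective (sym (m+[n∸m]≡n (m≤n⇒m≤1+n y≤n)))) (reassoc a P g r)

  bounds-in-T : ∀ {i} → i ∈ T → x ≤ i × (i < e ⊎ y ≤ i)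
  bounds-in-T i∈T with ∈-++⁻ (run x P) i∈T
  ... | inj₁ i∈run = let x≤i , i<e = All.lookup (run-bounds x P) i∈run in x≤i , inj₁ i<e
  ... | inj₂ i∈U   = ≤-trans (≤-trans (m≤m+n x P) (<⇒≤ e<y)) y≤i , inj₂ y≤i
    where
    y≤i = All.lookup U≥y i∈U

  before : filter ∉T? (run 1 (suc a)) ≡ run 1 (suc a)
  before = filter-all ∉T? (All.map (λ (_ , i<x) i∈T → <⇒≱ i<x (proj₁ (bounds-in-T i∈T)))
                                   (run-bounds 1 (suc a)))

  inside : filter ∉T? (run x P) ≡ []
  inside = filter-none ∉T? (All.tabulate (λ i∈run i∉T → i∉T (∈-++⁺ˡ i∈run)))

  between : filter ∉T? (run e (suc g)) ≡ run e (suc g)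
  between = filter-all ∉T? (All.map outside (run-bounds e (suc g)))
    where
    outside : ∀ {i} → e ≤ i × i < y → i ∉ T
    outside (e≤i , i<y) i∈T = [ (λ i<e → <⇒≱ i<e e≤i) , <⇒≱ i<y ]′ (proj₂ (bounds-in-T i∈T))

  complement≡ : complement n T ≡ run 1 (suc a) ++ run e (suc g) ++ rest
  complement≡ = begin
    filter ∉T? [ n ]ₙ
      ≡⟨ cong (filter ∉T?) [n]≡ ⟩
    filter ∉T? (run 1 (suc a) ++ run x P ++ run e (suc g) ++ run y r)
      ≡⟨ filter-++ ∉T? (run 1 (suc a)) _ ⟩
    filter ∉T? (run 1 (suc a)) ++ filter ∉T? (run x P ++ run e (suc g) ++ run y r)
      ≡⟨ cong (filter ∉T? (run 1 (suc a)) ++_) (filter-++ ∉T? (run x P) _) ⟩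
    filter ∉T? (run 1 (suc a)) ++ filter ∉T? (run x P) ++ filter ∉T? (run e (suc g) ++ run y r)
      ≡⟨ cong (λ R → filter ∉T? (run 1 (suc a)) ++ filter ∉T? (run x P) ++ R)
              (filter-++ ∉T? (run e (suc g)) _) ⟩
    filter ∉T? (run 1 (suc a)) ++ filter ∉T? (run x P) ++ filter ∉T? (run e (suc g)) ++ rest
      ≡⟨ cong₂ _++_ before (cong₂ _++_ inside (cong (_++ rest) between)) ⟩
    run 1 (suc a) ++ run e (suc g) ++ rest
      ∎

  rest-head : head rest ≢ just y
  rest-head with rest | all-filter ∉T? (run y r)
  ... | []    | _       = λ ()
  ... | _ ∷ _ | i∉T ∷ _ = λ { refl → i∉T (∈-++⁺ʳ (run x P) y∈U) }

  gaps≡ : gaps n T ≡ run 1 (suc a) ∷ run e (suc g) ∷ runs rest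
  gaps≡ = begin
    runs (complement n T)
      ≡⟨ cong runs complement≡ ⟩
    runs (run 1 (suc a) ++ run e (suc g) ++ rest)
      ≡⟨ runs-run-++ 1 a _ (m+1+n≢m x ∘ just-injective) ⟩
    run 1 (suc a) ∷ runs (run e (suc g) ++ rest)
      ≡⟨ cong (run 1 (suc a) ∷_) (runs-run-++ e g rest rest-head) ⟩
    run 1 (suc a) ∷ run e (suc g) ∷ runs rest
      ∎

secondGapSize-three-runs : ∀ {n T} (R : ThreeRuns T) → All (λ s → 1 ≤ s × s ≤ n) T → 1 ∉ T →
  let open ThreeRuns R in secondGapSize n T ≡ just (x₂ ∸ (x₁ + suc p₁))
secondGapSize-three-runs {n} record { x₁ = x₁ ; p₁ = p₁ ; x₂ = x₂ ; p₂ = p₂ ; x₃ = x₃ ; p₃ = p₃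
                                    ; T≡ = refl ; gap₁ = gap₁ ; gap₂ = gap₂ } T⊆[n] 1∉T =
  secondGapSize-run-++ n 2≤x₁ gap₁ x₂≤n U≥x₂ (here refl)
  where
  2≤x₁ : 2 ≤ x₁
  2≤x₁ = ≤∧≢⇒< (proj₁ (All.head T⊆[n])) (1∉T ∘ here)
  x₂≤n : x₂ ≤ n
  x₂≤n = proj₂ (All.lookup T⊆[n] (∈-++⁺ʳ (run x₁ (suc p₁)) (here refl)))
  U≥x₂ : All (x₂ ≤_) (run x₂ (suc p₂) ++ run x₃ (suc p₃))
  U≥x₂ = ++⁺ (All.map proj₁ (run-bounds x₂ (suc p₂)))
             (All.map (λ (x₃≤i , _) → ≤-trans x₂≤x₃ x₃≤i) (run-bounds x₃ (suc p₃)))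
    where
    x₂≤x₃ : x₂ ≤ x₃
    x₂≤x₃ = ≤-trans (m≤m+n x₂ (suc p₂)) (<⇒≤ gap₂)

∸≡1⇒≡+1 : ∀ {m n} → n ≤ m → m ∸ n ≡ 1 → m ≡ n + 1
∸≡1⇒≡+1 {m} {n} n≤m m∸n≡1 = trans (sym (m+[n∸m]≡n n≤m)) (cong (n +_) m∸n≡1)

-- Three blocks with a unit second gap

module UnitGapThreeBlocks (x₁ p₁ p₂ x₃ p₃ : ℕ) (sep₂ : x₁ + suc p₁ + 1 + suc p₂ ≤ x₃) where

  open ThreeBlocks x₁ p₁ (x₁ + suc p₁ + 1) p₂ x₃ p₃ (m≤m+n _ 1) sep₂

  P q k M D′ : ℕ
  P = suc p₁
  q = suc p₂
  k = length T
  M = k + suc q * k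
  D′ = p₁ + suc q * (P + q)

  weight : ℕ → ℕ
  weight i = suc M * count≤ e₃ [ i ] + (count≤ e₁ [ i ] + suc q * count≤ e₂ [ i ])

  threshold : ℕ
  threshold = suc M * k + D′

  e₂≡e₁+1+q : e₂ ≡ e₁ + suc q
  e₂≡e₁+1+q = shift x₁ p₁ p₂
    where
    shift : ∀ x₁ p₁ p₂ → x₁ + suc p₁ + 1 + p₂ ≡ x₁ + p₁ + suc (suc p₂)
    shift = solve-∀

  sum-weight : ∀ B → sum (map weight B) ≡ suc M * count≤ e₃ B + (count≤ e₁ B + suc q * count≤ e₂ B)
  sum-weight B = begin
    sum (map weight B)
      ≡⟨ sum-map-+ (λ i → suc M * 𝟙 e₃ i) _ B ⟩
    sum (map (λ i → suc M * 𝟙 e₃ i) B) + sum (map (λ i → 𝟙 e₁ i + suc q * 𝟙 e₂ i) B)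
      ≡⟨ cong₂ _+_ (sum-map-* (suc M) (𝟙 e₃) B) (sum-map-+ (𝟙 e₁) _ B) ⟩
    suc M * sum (map (𝟙 e₃) B) + (sum (map (𝟙 e₁) B) + sum (map (λ i → suc q * 𝟙 e₂ i) B))
      ≡⟨ cong₂ (λ a b → suc M * a + b) (sum-map-count≤ e₃ B)
           (cong₂ _+_ (sum-map-count≤ e₁ B)
                      (trans (sum-map-* (suc q) (𝟙 e₂) B) (cong (suc q *_) (sum-map-count≤ e₂ B)))) ⟩
    suc M * count≤ e₃ B + (count≤ e₁ B + suc q * count≤ e₂ B)
      ∎
    where
    open ≡-Reasoning
    𝟙 : ℕ → ℕ → ℕ
    𝟙 e i = count≤ e [ i ]

  pointwise⇔threshold : ∀ {B} → Linked _<_ B → length B ≡ k →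
    Pointwise _≤_ B T ⇔ (threshold < sum (map weight B))
  pointwise⇔threshold {B} B↑ |B|≡k = begin
    Pointwise _≤_ B T
      ≈⟨ pointwise⇔ends B↑ |B|≡k ⟩
    (P ≤ X₁ × P + q ≤ X₂ × k ≤ X₃)
      ≈⟨ mk⇔ (λ (h₁ , h₂ , h₃) → (h₁ , h₂) , h₃) (λ ((h₁ , h₂) , h₃) → h₁ , h₂ , h₃) ⟩
    ((P ≤ X₁ × P + q ≤ X₂) × k ≤ X₃)
      ≈⟨ two-thresholds⇔weighted X₁≤X₂ X₂≤X₁+1+q ×-⇔ ⇔-refl ⟩
    (suc D′ ≤ F × k ≤ X₃)
      ≈⟨ lexicographic-≤ (≤k e₃) F≤M ⟩
    suc M * k + suc D′ ≤ suc M * X₃ + F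
      ≡⟨ cong₂ _≤_ (+-suc (suc M * k) D′) (sym (sum-weight B)) ⟩
    threshold < sum (map weight B)
      ∎
    where
    open import Relation.Binary.Reasoning.Setoid (⇔-setoid 0ℓ)
    X₁ X₂ X₃ F : ℕ
    X₁ = count≤ e₁ B
    X₂ = count≤ e₂ B
    X₃ = count≤ e₃ B
    F = X₁ + suc q * X₂
    X₁≤X₂ : X₁ ≤ X₂
    X₁≤X₂ = count≤-mono (subst (e₁ ≤_) (sym e₂≡e₁+1+q) (m≤m+n e₁ (suc q))) B
    X₂≤X₁+1+q : X₂ ≤ X₁ + suc q
    X₂≤X₁+1+q =
      subst (λ e → count≤ e B ≤ X₁ + suc q) (sym e₂≡e₁+1+q) (count≤-lipschitz B↑ e₁ (suc q))
    ≤k : ∀ e → count≤ e B ≤ k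
    ≤k e = subst (count≤ e B ≤_) |B|≡k (count≤-≤-length e B)
    F≤M : F ≤ M
    F≤M = +-mono-≤ (≤k e₁) (*-monoʳ-≤ (suc q) (≤k e₂))

isThreshold-three-runs-unit-gap : ∀ n x₁ p₁ p₂ x₃ p₃ → x₁ + suc p₁ + 1 + suc p₂ ≤ x₃ →
  let T = run x₁ (suc p₁) ++ run (x₁ + suc p₁ + 1) (suc p₂) ++ run x₃ (suc p₃) in
  IsThreshold n (length T) (IsBasisOfShifted n (length T) T)
isThreshold-three-runs-unit-gap n x₁ p₁ p₂ x₃ p₃ sep₂ = isThreshold-from-ℕ-weights weight threshold
  λ B B-kset@(B↑ , _ , |B|≡k) → ⇔-trans (mk⇔ proj₂ (B-kset ,_)) (pointwise⇔threshold B↑ |B|≡k)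
  where open UnitGapThreeBlocks x₁ p₁ p₂ x₃ p₃ sep₂

corollary32 : (n k : ℕ) (T : List ℕ) → IsKSubset n k T → 1 ∉ T →
    length (blocks T) ≡ 3 → secondGapSize n T ≡ just 1 →
    IsThreshold n k (IsBasisOfShifted n k T)
corollary32 n k T (T↑ , T⊆[n] , |T|≡k) 1∉T three-blocks unit-gap
  with three-runs T↑ three-blocks
... | R@record { x₁ = x₁ ; p₁ = p₁ ; x₂ = x₂ ; p₂ = p₂ ; x₃ = x₃ ; p₃ = p₃
               ; T≡ = refl ; gap₁ = gap₁ ; gap₂ = gap₂ }
  with refl ← |T|≡k
     | refl ← ∸≡1⇒≡+1 (<⇒≤ gap₁)
                (just-injective (trans (sym (secondGapSize-three-runs R T⊆[n] 1∉T)) unit-gap))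
  = isThreshold-three-runs-unit-gap n x₁ p₁ p₂ x₃ p₃ (<⇒≤ gap₂)
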